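{- Let $C'$ be a projective $[n',k',d']_2$-code with $k'\ge 2$. Then $n_2(k'+1,\min\{2d',n'+1\},2)\le 2n'+1$.
   Context: An $[n,k,d]_q$-code is a $k$-dimensional subspace of $\mathbb{F}_q^n$ with minimum Hamming distance at least $d$. A code is projective if no column of a generator matrix is zero and no column is a scalar multiple of another column. A linear code $C\subseteq\mathbb{F}_q^n$ has locality $r$ if for every coordinate $i$ there is a set $S_i\subseteq\{1,\dots,n\}\setminus\{i\}$ with $|S_i|\le r$ such that any two codewords agreeing on all coordinates in $S_i$ also agree in coordinate $i$. $n_q(k,d,r)$ denotes the minimum length $n$ of an $[n,k,d]_q$-code with locality $r$. -}

module Defs where

open import Data.Bool using (Bool; true; false; _xor_; _∧_)
open import Data.Nat using (ℕ; zero; suc; _+_; _≤_)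
open import Data.Fin using (Fin)
open import Data.Fin.Subset using (Subset; _∈_; _∉_; ∣_∣)
open import Data.Product using (Σ; ∃; _×_)
open import Relation.Binary.PropositionalEquality using (_≡_)
open import Relation.Nullary using (¬_)

-- The field F_2 is modelled by Bool with addition _xor_ and multiplication _∧_.

Σ₂ : (k : ℕ) → (Fin k → Bool) → Bool
Σ₂ zero    f = false
Σ₂ (suc k) f = f Fin.zero xor Σ₂ k (λ i → f (Fin.suc i))

count : (k : ℕ) → (Fin k → Bool) → ℕ
count zero    f = 0
count (suc k) f = (if f Fin.zero then 1 else 0) + count k (λ i → f (Fin.suc i))
  where open import Data.Bool using (if_then_else_)

Word : ℕ → Set
Word n = Fin n → Bool

weight : {n : ℕ} → Word n → ℕ
weight {n} w = count n w

NonZero₂ : {n : ℕ} → Word n → Set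
NonZero₂ {n} w = ∃ λ (i : Fin n) → w i ≡ true

GenMat : ℕ → ℕ → Set
GenMat k n = Fin k → Fin n → Bool

encode : {k n : ℕ} → GenMat k n → Word k → Word n
encode {k} G x j = Σ₂ k (λ i → x i ∧ G i j)

-- The code generated by G (its row space) is an [n,k,d]_2-code:
-- the rows are linearly independent (so the row space has dimension k)
-- and every nonzero codeword has Hamming weight at least d.
IsCode : (n k d : ℕ) → GenMat k n → Set
IsCode n k d G =
  ((x : Word k) → NonZero₂ x → NonZero₂ (encode G x)) ×
  ((x : Word k) → NonZero₂ x → d ≤ weight (encode G x))

-- Projective: no zero column and no column a scalar multiple of another
-- (over F_2 the only nonzero scalar is 1, so: no two equal columns).
Projective : {k n : ℕ} → GenMat k n → Set
Projective {k} {n} G =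
  ((j : Fin n) → NonZero₂ (λ i → G i j)) ×
  ((j j′ : Fin n) → ¬ (j ≡ j′) → ¬ ((i : Fin k) → G i j ≡ G i j′))

HasLocality : {k n : ℕ} → ℕ → GenMat k n → Set
HasLocality {k} {n} r G =
  (i : Fin n) → Σ (Subset n) λ S →
    (i ∉ S) × (∣ S ∣ ≤ r) ×
    ((x y : Word k) →
       ((j : Fin n) → j ∈ S → encode G x j ≡ encode G y j) →
       encode G x i ≡ encode G y i)

HasLRC : (n k d r : ℕ) → Set
HasLRC n k d r = Σ (GenMat k n) λ G → IsCode n k d G × HasLocality r G

-- "n_2(k,d,r) ≤ N": the minimum length of an [n,k,d]_2-code with
-- locality r is at most N, i.e. such a code of some length n ≤ N exists.
n₂≤ : (k d r N : ℕ) → Set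
n₂≤ k d r N = ∃ λ n → n ≤ N × HasLRC n k d r

{-# OPTIONS --safe #-}
module Submission where

-- Extend G to the generator matrix [[1, 0, 𝟙], [0, G, G]] of length 2n′ + 1, 𝟙 the all-ones row, so that
-- the message (b, y) is encoded as (b, c, c + b𝟙) with c = yG. For b = 0 its weight is 2 wt(c) ≥ 2d′, and
-- for b = 1 it is 1 + wt(c) + (n′ − wt(c)) = n′ + 1. Every coordinate is the sum of two others, namely
-- b = c_j + (c_j + b) and c_j = b + (c_j + b), so each has a recovery set of size 2.

open import Defs
open import Data.Nat using (ℕ; zero; suc; _+_; _*_; _≤_; _⊓_; s≤s)
open import Data.Nat.Properties
  using (≤-refl; ≤-reflexive; ≤-trans; n≤1+n; +-suc; +-comm; +-identityʳ; +-assoc; +-mono-≤; m⊓n≤m; m⊓n≤n)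
open import Data.Bool using (Bool; true; false; _xor_; _∧_; not; if_then_else_)
open import Data.Bool.Properties using (∧-zeroʳ; ∧-identityʳ; xor-assoc; xor-comm; xor-same; xor-identityʳ)
open import Data.Fin using (Fin; _↑ˡ_; _↑ʳ_; splitAt)
open import Data.Fin.Properties using (splitAt-↑ˡ; splitAt-↑ʳ; splitAt⁻¹-↑ˡ; splitAt⁻¹-↑ʳ; suc-injective)
open import Data.Fin.Subset using (Subset; _∈_; _∉_; ∣_∣; ⁅_⁆; _∪_)
open import Data.Fin.Subset.Properties using (x∈⁅x⁆; x∈⁅y⁆⇒x≡y; x∈p∪q⁻; x∈p∪q⁺; ∣⁅x⁆∣≡1)
open import Data.Vec using ([]; _∷_)
open import Data.Vec.Functional using (head; tail; map; _++_) renaming (_∷_ to _◂_)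
open import Data.Vec.Functional.Properties using (lookup-++ˡ; lookup-++ʳ)
open import Data.Sum using (_⊎_; inj₁; inj₂; [_,_]′; map₂)
open import Data.Sum.Properties using ([,]-map)
open import Data.Product using (Σ; ∃; ∃₂; _×_; _,_; proj₁; uncurry)
open import Function using (_∘_)
open import Relation.Binary.PropositionalEquality

xor-cancelˡ : ∀ x y → x xor (x xor y) ≡ y
xor-cancelˡ x y = trans (sym (xor-assoc x x y)) (cong (_xor y) (xor-same x))

Σ₂-∧-false : ∀ k (x : Fin k → Bool) → Σ₂ k (λ i → x i ∧ false) ≡ false
Σ₂-∧-false zero    x = refl
Σ₂-∧-false (suc k) x rewrite ∧-zeroʳ (x Fin.zero) = Σ₂-∧-false k (tail x)

Σ₂-cong : ∀ k {f g : Fin k → Bool} → f ≗ g → Σ₂ k f ≡ Σ₂ k g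
Σ₂-cong zero    f≗g = refl
Σ₂-cong (suc k) f≗g = cong₂ _xor_ (f≗g Fin.zero) (Σ₂-cong k (f≗g ∘ Fin.suc))

count-cong : ∀ n {f g : Fin n → Bool} → f ≗ g → count n f ≡ count n g
count-cong zero    f≗g = refl
count-cong (suc n) f≗g =
  cong₂ _+_ (cong (λ b → if b then 1 else 0) (f≗g Fin.zero)) (count-cong n (f≗g ∘ Fin.suc))

count-++ : ∀ m n (f : Fin m → Bool) (g : Fin n → Bool) →
           count (m + n) (f ++ g) ≡ count m f + count n g
count-++ zero    n f g = refl
count-++ (suc m) n f g = begin
  b + count (m + n) (tail (f ++ g))   ≡⟨ cong (b +_) (count-cong (m + n) ([,]-map ∘ splitAt m)) ⟩
  b + count (m + n) (tail f ++ g)     ≡⟨ cong (b +_) (count-++ m n (tail f) g) ⟩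
  b + (count m (tail f) + count n g)  ≡⟨ sym (+-assoc b _ _) ⟩
  b + count m (tail f) + count n g    ∎
  where open ≡-Reasoning
        b = if f Fin.zero then 1 else 0

count-+-count-not : ∀ n (f : Fin n → Bool) → count n f + count n (not ∘ f) ≡ n
count-+-count-not zero    f = refl
count-+-count-not (suc n) f with f Fin.zero
... | true  = cong suc (count-+-count-not n (tail f))
... | false = trans (+-suc _ _) (cong suc (count-+-count-not n (tail f)))

∣p∪q∣≤∣p∣+∣q∣ : ∀ {n} (p q : Subset n) → ∣ p ∪ q ∣ ≤ ∣ p ∣ + ∣ q ∣
∣p∪q∣≤∣p∣+∣q∣ []          []          = ≤-refl
∣p∪q∣≤∣p∣+∣q∣ (true ∷ p)  (true ∷ q)  =
  s≤s (≤-trans (∣p∪q∣≤∣p∣+∣q∣ p q) (≤-trans (n≤1+n _) (≤-reflexive (sym (+-suc ∣ p ∣ ∣ q ∣)))))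
∣p∪q∣≤∣p∣+∣q∣ (true ∷ p)  (false ∷ q) = s≤s (∣p∪q∣≤∣p∣+∣q∣ p q)
∣p∪q∣≤∣p∣+∣q∣ (false ∷ p) (true ∷ q)  =
  ≤-trans (s≤s (∣p∪q∣≤∣p∣+∣q∣ p q)) (≤-reflexive (sym (+-suc ∣ p ∣ ∣ q ∣)))
∣p∪q∣≤∣p∣+∣q∣ (false ∷ p) (false ∷ q) = ∣p∪q∣≤∣p∣+∣q∣ p q

↑ˡ≢↑ʳ : ∀ m n (i : Fin m) (j : Fin n) → i ↑ˡ n ≢ m ↑ʳ j
↑ˡ≢↑ʳ m n i j eq with trans (sym (splitAt-↑ˡ m i n)) (trans (cong (splitAt m) eq) (splitAt-↑ʳ m n j))
... | ()

↑ˡ-or-↑ʳ : ∀ m n (i : Fin (m + n)) → (∃ λ j → j ↑ˡ n ≡ i) ⊎ (∃ λ j → m ↑ʳ j ≡ i)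
↑ˡ-or-↑ʳ m n i with splitAt m i in eq
... | inj₁ j = inj₁ (j , splitAt⁻¹-↑ˡ eq)
... | inj₂ j = inj₂ (j , splitAt⁻¹-↑ʳ eq)

NonZero₂-head-or-tail : ∀ {k} (x : Word (suc k)) → NonZero₂ x → head x ≡ true ⊎ NonZero₂ (tail x)
NonZero₂-head-or-tail x (Fin.zero  , x₀≡true) = inj₁ x₀≡true
NonZero₂-head-or-tail x (Fin.suc i , xᵢ≡true) = inj₂ (i , xᵢ≡true)

RecoverySet : ∀ {k n} → ℕ → GenMat k n → Fin n → Set
RecoverySet {k} {n} r H i = Σ (Subset n) λ S →
  (i ∉ S) × (∣ S ∣ ≤ r) ×
  ((x y : Word k) → ((j : Fin n) → j ∈ S → encode H x j ≡ encode H y j) →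
     encode H x i ≡ encode H y i)

SumOfTwoOthers : ∀ {A : Set} {n} → (A → Word n) → Fin n → Set
SumOfTwoOthers {A} {n} word i =
  ∃₂ λ (a b : Fin n) → i ≢ a × i ≢ b × ((x : A) → word x i ≡ word x a xor word x b)

SumOfTwoOthers-reindex : ∀ {A B : Set} {n} {word : A → Word n} {word′ : B → Word n} (φ : B → A) →
  (∀ y → word′ y ≗ word (φ y)) → ∀ {i} → SumOfTwoOthers word i → SumOfTwoOthers word′ i
SumOfTwoOthers-reindex φ eq {i} (a , b , i≢a , i≢b , sum) =
  a , b , i≢a , i≢b , λ y → trans (eq y i) (trans (sum (φ y)) (sym (cong₂ _xor_ (eq y a) (eq y b))))

recoverySet-pair : ∀ {k n} (H : GenMat k n) {i} → SumOfTwoOthers (encode H) i → RecoverySet 2 H i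
recoverySet-pair H {i} (a , b , i≢a , i≢b , sum) = ⁅ a ⁆ ∪ ⁅ b ⁆ , i∉S , ∣S∣≤2 , recover
  where
  i∉S : i ∉ ⁅ a ⁆ ∪ ⁅ b ⁆
  i∉S i∈S = [ i≢a ∘ x∈⁅y⁆⇒x≡y a , i≢b ∘ x∈⁅y⁆⇒x≡y b ]′ (x∈p∪q⁻ ⁅ a ⁆ ⁅ b ⁆ i∈S)

  ∣S∣≤2 : ∣ ⁅ a ⁆ ∪ ⁅ b ⁆ ∣ ≤ 2
  ∣S∣≤2 = ≤-trans (∣p∪q∣≤∣p∣+∣q∣ ⁅ a ⁆ ⁅ b ⁆) (≤-reflexive (cong₂ _+_ (∣⁅x⁆∣≡1 a) (∣⁅x⁆∣≡1 b)))

  recover : ∀ x y → (∀ j → j ∈ ⁅ a ⁆ ∪ ⁅ b ⁆ → encode H x j ≡ encode H y j) → encode H x i ≡ encode H y i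
  recover x y agree = begin
    encode H x i                        ≡⟨ sum x ⟩
    encode H x a xor encode H x b       ≡⟨ cong₂ _xor_ (agree a (x∈p∪q⁺ (inj₁ (x∈⁅x⁆ a))))
                                                       (agree b (x∈p∪q⁺ (inj₂ (x∈⁅x⁆ b)))) ⟩
    encode H y a xor encode H y b       ≡⟨ sum y ⟨
    encode H y i                        ∎
    where open ≡-Reasoning

doubled : ∀ {n} → Bool → Word n → Word (suc (n + n))
doubled b c = b ◂ (c ++ map (b xor_) c)

doubledGenMat : ∀ {k n} → GenMat k n → GenMat (suc k) (suc (n + n))
doubledGenMat {n = n} G = doubled {n} true (λ _ → false) ◂ (λ i → doubled false (G i))

module _ {n : ℕ} where

  doubled-left : ∀ b (c : Word n) j → doubled b c (Fin.suc (j ↑ˡ n)) ≡ c j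
  doubled-left b c j = lookup-++ˡ c (map (b xor_) c) j

  doubled-right : ∀ b (c : Word n) j → doubled b c (Fin.suc (n ↑ʳ j)) ≡ b xor c j
  doubled-right b c j = lookup-++ʳ c (map (b xor_) c) j

  weight-doubled-true : (c : Word n) → weight (doubled true c) ≡ suc n
  weight-doubled-true c = cong suc (trans (count-++ n n c _) (count-+-count-not n c))

  weight-doubled-false : (c : Word n) → weight (doubled false c) ≡ weight c + weight c
  weight-doubled-false c = count-++ n n c c

  doubled-nonzero : ∀ b (c : Word n) → b ≡ true ⊎ NonZero₂ c → NonZero₂ (doubled b c)
  doubled-nonzero b c (inj₁ b≡true)    = Fin.zero , b≡true
  doubled-nonzero b c (inj₂ (j , cⱼ)) = Fin.suc (j ↑ˡ n) , trans (doubled-left b c j) cⱼ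

  doubled-weight : ∀ {d} b (c : Word n) → b ≡ true ⊎ d ≤ weight c →
                   (2 * d) ⊓ (n + 1) ≤ weight (doubled b c)
  doubled-weight {d} true c _ = ≤-trans (m⊓n≤n (2 * d) (n + 1))
    (≤-reflexive (trans (+-comm n 1) (sym (weight-doubled-true c))))
  doubled-weight {d} false c (inj₂ d≤wc) = ≤-trans (m⊓n≤m (2 * d) (n + 1))
    (≤-trans (+-mono-≤ d≤wc (≤-trans (≤-reflexive (+-identityʳ d)) d≤wc))
             (≤-reflexive (sym (weight-doubled-false c))))

  doubled-sumOfTwoOthers : Fin n → ∀ i → SumOfTwoOthers (uncurry (doubled {n})) i
  doubled-sumOfTwoOthers j₀ Fin.zero =
    Fin.suc (j₀ ↑ˡ n) , Fin.suc (n ↑ʳ j₀) , (λ ()) , (λ ()) , λ (b , c) → sym (begin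
      doubled b c (Fin.suc (j₀ ↑ˡ n)) xor doubled b c (Fin.suc (n ↑ʳ j₀))
        ≡⟨ cong₂ _xor_ (doubled-left b c j₀) (doubled-right b c j₀) ⟩
      c j₀ xor (b xor c j₀)   ≡⟨ cong (c j₀ xor_) (xor-comm b (c j₀)) ⟩
      c j₀ xor (c j₀ xor b)   ≡⟨ xor-cancelˡ (c j₀) b ⟩
      b                       ∎)
    where open ≡-Reasoning
  doubled-sumOfTwoOthers j₀ (Fin.suc i) with ↑ˡ-or-↑ʳ n n i
  ... | inj₁ (j , refl) = Fin.zero , Fin.suc (n ↑ʳ j) , (λ ()) ,
    (λ eq → ↑ˡ≢↑ʳ n n j j (suc-injective eq)) , λ (b , c) → begin
      doubled b c (Fin.suc (j ↑ˡ n))        ≡⟨ doubled-left b c j ⟩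
      c j                                   ≡⟨ xor-cancelˡ b (c j) ⟨
      b xor (b xor c j)                     ≡⟨ cong (b xor_) (doubled-right b c j) ⟨
      b xor doubled b c (Fin.suc (n ↑ʳ j))  ∎
    where open ≡-Reasoning
  ... | inj₂ (j , refl) = Fin.zero , Fin.suc (j ↑ˡ n) , (λ ()) ,
    (λ eq → ↑ˡ≢↑ʳ n n j j (sym (suc-injective eq))) , λ (b , c) →
      trans (doubled-right b c j) (cong (b xor_) (sym (doubled-left b c j)))

module _ {k n : ℕ} (G : GenMat k n) where

  encode-doubledGenMat : ∀ x → encode (doubledGenMat G) x ≗ doubled (head x) (encode G (tail x))
  encode-doubledGenMat x Fin.zero =
    trans (cong₂ _xor_ (∧-identityʳ (head x)) (Σ₂-∧-false k (tail x))) (xor-identityʳ (head x))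
  encode-doubledGenMat x (Fin.suc p) with ↑ˡ-or-↑ʳ n n p
  ... | inj₁ (j , refl) = begin
    encode (doubledGenMat G) x (Fin.suc (j ↑ˡ n))
      ≡⟨ cong₂ _xor_ (cong (head x ∧_) (doubled-left true (λ _ → false) j))
                     (Σ₂-cong k (λ i → cong (tail x i ∧_) (doubled-left false (G i) j))) ⟩
    (head x ∧ false) xor encode G (tail x) j
      ≡⟨ cong (_xor encode G (tail x) j) (∧-zeroʳ (head x)) ⟩
    encode G (tail x) j
      ≡⟨ doubled-left (head x) (encode G (tail x)) j ⟨
    doubled (head x) (encode G (tail x)) (Fin.suc (j ↑ˡ n)) ∎
    where open ≡-Reasoning
  ... | inj₂ (j , refl) = begin
    encode (doubledGenMat G) x (Fin.suc (n ↑ʳ j))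
      ≡⟨ cong₂ _xor_ (cong (head x ∧_) (doubled-right true (λ _ → false) j))
                     (Σ₂-cong k (λ i → cong (tail x i ∧_) (doubled-right false (G i) j))) ⟩
    (head x ∧ true) xor encode G (tail x) j
      ≡⟨ cong (_xor encode G (tail x) j) (∧-identityʳ (head x)) ⟩
    head x xor encode G (tail x) j
      ≡⟨ doubled-right (head x) (encode G (tail x)) j ⟨
    doubled (head x) (encode G (tail x)) (Fin.suc (n ↑ʳ j)) ∎
    where open ≡-Reasoning

  doubledGenMat-isCode : ∀ {d} → IsCode n k d G →
                         IsCode (suc (n + n)) (suc k) ((2 * d) ⊓ (n + 1)) (doubledGenMat G)
  doubledGenMat-isCode {d} (nonzero , heavy) = nonzero⁺ , heavy⁺
    where
    nonzero⁺ : ∀ x → NonZero₂ x → NonZero₂ (encode (doubledGenMat G) x)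
    nonzero⁺ x x≢0
      with doubled-nonzero (head x) (encode G (tail x)) (map₂ (nonzero (tail x)) (NonZero₂-head-or-tail x x≢0))
    ... | p , doubledₚ≡true = p , trans (encode-doubledGenMat x p) doubledₚ≡true

    heavy⁺ : ∀ x → NonZero₂ x → (2 * d) ⊓ (n + 1) ≤ weight (encode (doubledGenMat G) x)
    heavy⁺ x x≢0 = ≤-trans
      (doubled-weight (head x) (encode G (tail x)) (map₂ (heavy (tail x)) (NonZero₂-head-or-tail x x≢0)))
      (≤-reflexive (count-cong (suc (n + n)) (sym ∘ encode-doubledGenMat x)))

  doubledGenMat-locality : Fin n → HasLocality 2 (doubledGenMat G)
  doubledGenMat-locality j₀ i = recoverySet-pair (doubledGenMat G)
    (SumOfTwoOthers-reindex {word = uncurry doubled} (λ x → head x , encode G (tail x))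
                            encode-doubledGenMat (doubled-sumOfTwoOthers j₀ i))

lemma21 : (n′ k′ d′ : ℕ) (G : GenMat k′ n′) →
    IsCode n′ k′ d′ G → Projective G → 2 ≤ k′ →
    n₂≤ (suc k′) ((2 * d′) ⊓ (n′ + 1)) 2 (2 * n′ + 1)
lemma21 n′ (suc k) d′ G code _ (s≤s _) =
  suc (n′ + n′) , ≤-reflexive length ,
  doubledGenMat G , doubledGenMat-isCode G code , doubledGenMat-locality G j₀
  where
  j₀ : Fin n′
  j₀ = proj₁ (proj₁ code (λ _ → true) (Fin.zero , refl))

  length : suc (n′ + n′) ≡ 2 * n′ + 1
  length = trans (cong (λ m → suc (n′ + m)) (sym (+-identityʳ n′))) (+-comm 1 (2 * n′))
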